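{- Let $\sigma\in S_n$ and let $D_\sigma=\{(n+1-b,a):(a,b)\in\mathrm{Inv}(\sigma)\}\subset\mathbb N_{>0}^2$ (row index first). Let $\rho_{YX}$ be the partition whose parts are the nonzero row lengths of $D_\sigma$ in nonincreasing order, and let $\rho_{XY}$ be the partition whose conjugate has as parts the nonzero column lengths of $D_\sigma$ in nonincreasing order (these are the Ferrers diagrams obtained by pushing the boxes of $D_\sigma$ first against the vertical axis and then the horizontal one, resp. first horizontally and then vertically). Then $\sigma$ is vexillary if and only if $\rho_{XY}=\rho_{YX}$.
   Context: For $\sigma\in S_n$, $\mathrm{Inv}(\sigma)=\{(a,b):1\le a<b\le n,\ \sigma^{ -1}(a)>\sigma^{ -1}(b)\}$. $d_i(\sigma)=|\{j>i:\sigma(j)<\sigma(i)\}|$, $g_i(\sigma)=|\{j<i:\sigma(j)>\sigma(i)\}|$; $\mu(\sigma)$ and $\lambda(\sigma)$ are the partitions obtained by sorting $(d_i)$, resp. $(g_i)$, in nonincreasing order; $\sigma$ is vexillary iff $\lambda(\sigma)=\mu(\sigma)'$, where $'$ denotes conjugation. -}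

module Defs where

open import Data.Nat using (ℕ; zero; suc; _+_; _∸_; _<?_)
open import Data.Nat.Properties using (≤-decTotalOrder; _≟_)
import Data.Fin as F
open import Data.Fin using (Fin; toℕ)
open import Data.Fin.Permutation using (Permutation′; _⟨$⟩ʳ_; _⟨$⟩ˡ_)
open import Data.List using (List; []; _∷_; length; filter; map; allFin; reverse; concatMap; applyUpTo; head)
open import Data.List.Sort ≤-decTotalOrder using (sort)
open import Data.Product using (_×_; _,_; proj₁; proj₂)
open import Data.Maybe using (fromMaybe)
open import Relation.Nullary using (Dec; _×-dec_)
open import Relation.Binary.PropositionalEquality using (_≡_)

-- A permutation σ ∈ S_n is a bijection Fin n ↔ Fin n; the values 1..n
-- of the paper are encoded by Fin n (value k ↦ toℕ k + 1).

toPartition : List ℕ → List ℕ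
toPartition xs = reverse (sort (filter (λ x → 0 <? x) xs))

-- conjugate of a partition λ (nonincreasing list of positive parts):
-- λ'_k = #{ i : λ_i ≥ k } for k = 1 .. λ_1
conjugate : List ℕ → List ℕ
conjugate λs = applyUpTo (λ k → length (filter (λ x → suc k Data.Nat.≤? x) λs))
                         (fromMaybe 0 (head λs))

d : ∀ {n} → Permutation′ n → Fin n → ℕ
d {n} σ i = length (filter (λ j → (i F.<? j) ×-dec ((σ ⟨$⟩ʳ j) F.<? (σ ⟨$⟩ʳ i))) (allFin n))

g : ∀ {n} → Permutation′ n → Fin n → ℕ
g {n} σ i = length (filter (λ j → (j F.<? i) ×-dec ((σ ⟨$⟩ʳ i) F.<? (σ ⟨$⟩ʳ j))) (allFin n))

μ : ∀ {n} → Permutation′ n → List ℕ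
μ {n} σ = toPartition (map (d σ) (allFin n))

λ′ : ∀ {n} → Permutation′ n → List ℕ
λ′ {n} σ = toPartition (map (g σ) (allFin n))

Vexillary : ∀ {n} → Permutation′ n → Set
Vexillary σ = λ′ σ ≡ conjugate (μ σ)

inv? : ∀ {n} (σ : Permutation′ n) (a b : Fin n) →
       Dec ((a F.< b) × ((σ ⟨$⟩ˡ b) F.< (σ ⟨$⟩ˡ a)))
inv? σ a b = (a F.<? b) ×-dec ((σ ⟨$⟩ˡ b) F.<? (σ ⟨$⟩ˡ a))

Inv : ∀ {n} → Permutation′ n → List (ℕ × ℕ)
Inv {n} σ = concatMap (λ a → map (λ b → (toℕ a + 1 , toℕ b + 1))
                                  (filter (inv? σ a) (allFin n)))
                      (allFin n)

Dσ : ∀ {n} → Permutation′ n → List (ℕ × ℕ)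
Dσ {n} σ = map (λ ab → (suc n ∸ proj₂ ab , proj₁ ab)) (Inv σ)

rowLength : List (ℕ × ℕ) → ℕ → ℕ
rowLength D r = length (filter (λ x → proj₁ x ≟ r) D)

colLength : List (ℕ × ℕ) → ℕ → ℕ
colLength D c = length (filter (λ x → proj₂ x ≟ c) D)

-- all cells of D_σ lie in [1,n]², so rows/columns 1..n cover every
-- nonzero row/column
ρYX : ∀ {n} → Permutation′ n → List ℕ
ρYX {n} σ = toPartition (applyUpTo (λ r → rowLength (Dσ σ) (suc r)) n)

ρXY : ∀ {n} → Permutation′ n → List ℕ
ρXY {n} σ = conjugate (toPartition (applyUpTo (λ c → colLength (Dσ σ) (suc c)) n))

module Submission where

-- Row n+1-b of D_σ consists of the a < b with σ⁻¹(a) > σ⁻¹(b); putting j = σ⁻¹(a), these are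
-- the j > σ⁻¹(b) with σ(j) < b, so the row has length d at position σ⁻¹(b). Likewise column a
-- has length g at position σ⁻¹(a). As σ is a bijection, the row lengths of D_σ are a
-- rearrangement of (d_i) and the column lengths one of (g_i); hence ρ_YX = μ(σ) and
-- ρ_XY = λ(σ)'. Conjugation is an involution on partitions, so λ = μ' iff λ' = μ.

open import Defs
open import Data.Nat using (ℕ; zero; suc; _+_; _∸_; _≤_; _<_; _≥_; _⊓_; _≤?_; _<?_; z≤n; s≤s)
open import Data.Nat.Properties
open import Data.Nat.ListAction using (sum)
open import Data.Fin using (Fin; toℕ; opposite)
import Data.Fin as Fin
import Data.Fin.Properties as Fin
open import Data.Fin.Permutation using (Permutation′; _⟨$⟩ʳ_; _⟨$⟩ˡ_; inverseˡ; inverseʳ; _∘ₚ_)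
import Data.Fin.Permutation as Perm
open import Data.List
  using (List; []; _∷_; _++_; length; filter; map; lookup; reverse; allFin; tabulate; concatMap; applyUpTo)
open import Data.List.Properties
open import Data.List.Sort ≤-decTotalOrder using (sort-↭; sort-↗)
open import Data.List.Relation.Unary.All as All using (All; []; _∷_)
open import Data.List.Relation.Unary.All.Properties using (all-filter)
open import Data.List.Relation.Unary.AllPairs using (AllPairs; []; _∷_)
import Data.List.Relation.Unary.AllPairs.Properties as AllPairs
open import Data.List.Relation.Unary.Linked.Properties using (Linked⇒AllPairs)
open import Data.List.Relation.Unary.Sorted.TotalOrder.Properties using (↗↭↗⇒≋)
open import Data.List.Relation.Unary.Unique.Propositional.Properties using (tabulate⁺; allFin⁺)
open import Data.List.Relation.Binary.Pointwise using (Pointwise-≡⇒≡; lookup⁻)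
open import Data.List.Relation.Binary.Permutation.Propositional using (_↭_; ↭-sym; ↭-trans; ↭⇒↭ₛ)
open import Data.List.Relation.Binary.Permutation.Propositional.Properties
  using (filter-↭; All-resp-↭; ↭-reverse; ↭-length)
import Data.List.Relation.Binary.Permutation.Propositional.Properties as ↭
open import Data.List.Relation.Binary.BagAndSetEquality using (∼bag⇒↭)
open import Data.List.Membership.Propositional using (_∈_)
open import Data.List.Membership.Propositional.Properties using (∈-allFin; ∈-tabulate⁺)
open import Data.List.Membership.Propositional.Properties.WithK using (unique∧set⇒bag)
open import Data.Product using (_×_; _,_; proj₁; proj₂)
open import Function using (_∘_; _$_; flip; _⇔_; mk⇔; Equivalence)
open import Level using (Level)
open import Relation.Binary using (Rel; DecTotalOrder)
open import Relation.Binary.PropositionalEquality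
open import Relation.Nullary using (Dec; yes; no; ¬_; contradiction; _×-dec_)
open import Relation.Unary using (Pred; Decidable)

open Equivalence using (to; from)

private
  variable
    a b p q : Level
    A : Set a
    B : Set b

-- Partitions and conjugation

IsPartition : List ℕ → Set
IsPartition λs = AllPairs _≥_ λs × All (0 <_) λs

-- Definitionally, conjugate λs = applyUpTo (λ k → countAtLeast (suc k) λs) (largest part of λs).
countAtLeast : ℕ → List ℕ → ℕ
countAtLeast t xs = length (filter (t ≤?_) xs)

countAtLeast-none : ∀ {t} xs → All (_< t) xs → countAtLeast t xs ≡ 0
countAtLeast-none {t} xs xs<t = cong length (filter-none (t ≤?_) (All.map <⇒≱ xs<t))

countAtLeast-all : ∀ {t} xs → All (t ≤_) xs → countAtLeast t xs ≡ length xs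
countAtLeast-all {t} xs t≤xs = cong length (filter-all (t ≤?_) t≤xs)

countAtLeast-∷-≤ : ∀ {t x} xs → t ≤ x → countAtLeast t (x ∷ xs) ≡ suc (countAtLeast t xs)
countAtLeast-∷-≤ {t} _ t≤x = cong length (filter-accept (t ≤?_) t≤x)

countAtLeast-∷-≰ : ∀ {t x} xs → ¬ t ≤ x → countAtLeast t (x ∷ xs) ≡ countAtLeast t xs
countAtLeast-∷-≰ {t} _ t≰x = cong length (filter-reject (t ≤?_) t≰x)

lookup-≤ : ∀ {x xs} → All (_≤ x) xs → (j : Fin (length (x ∷ xs))) → lookup (x ∷ xs) j ≤ x
lookup-≤ _          Fin.zero              = ≤-refl
lookup-≤ (y≤x ∷ _)  (Fin.suc Fin.zero)    = y≤x
lookup-≤ (_ ∷ ys≤x) (Fin.suc (Fin.suc j)) = lookup-≤ ys≤x (Fin.suc j)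

<-countAtLeast⇔≤-lookup : ∀ t {λs} → AllPairs _≥_ λs → (j : Fin (length λs)) →
                          toℕ j < countAtLeast t λs ⇔ t ≤ lookup λs j
<-countAtLeast⇔≤-lookup t {x ∷ xs} (x≥xs ∷ _) j with t ≤? x
<-countAtLeast⇔≤-lookup t {x ∷ xs} _ Fin.zero | yes t≤x
  rewrite countAtLeast-∷-≤ xs t≤x = mk⇔ (λ _ → t≤x) (λ _ → s≤s z≤n)
<-countAtLeast⇔≤-lookup t {x ∷ xs} (_ ∷ ≥-xs) (Fin.suc j) | yes t≤x
  rewrite countAtLeast-∷-≤ xs t≤x = mk⇔ (to IH ∘ ≤-pred) (s≤s ∘ from IH)
  where IH = <-countAtLeast⇔≤-lookup t ≥-xs j
<-countAtLeast⇔≤-lookup t {x ∷ xs} (x≥xs ∷ _) j | no t≰x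
  rewrite countAtLeast-∷-≰ xs t≰x = mk⇔
    (λ j<0 → contradiction (subst (toℕ j <_) none j<0) λ ())
    (λ t≤xⱼ → contradiction (≤-trans t≤xⱼ (lookup-≤ x≥xs j)) t≰x)
  where none = countAtLeast-none xs (All.map (λ y≤x → ≤-<-trans y≤x (≰⇒> t≰x)) x≥xs)

countAtLeast-applyUpTo : ∀ {t} (f : ℕ → ℕ) a h → (∀ k → t ≤ f k ⇔ k < a) →
                         countAtLeast t (applyUpTo f h) ≡ a ⊓ h
countAtLeast-applyUpTo f a zero _ = sym (⊓-zeroʳ a)
countAtLeast-applyUpTo {t} f a (suc h) t≤f⇔<a with t ≤? f 0
countAtLeast-applyUpTo f zero (suc h) t≤f⇔<a | yes t≤f₀ =
  contradiction (to (t≤f⇔<a 0) t≤f₀) λ ()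
countAtLeast-applyUpTo f (suc a) (suc h) t≤f⇔<a | yes t≤f₀ =
  trans (countAtLeast-∷-≤ _ t≤f₀) $ cong suc $ countAtLeast-applyUpTo (f ∘ suc) a h λ k →
    mk⇔ (≤-pred ∘ to (t≤f⇔<a (suc k))) (from (t≤f⇔<a (suc k)) ∘ s≤s)
countAtLeast-applyUpTo f zero (suc h) t≤f⇔<a | no t≰f₀ =
  trans (countAtLeast-∷-≰ _ t≰f₀) $ countAtLeast-applyUpTo (f ∘ suc) zero h λ k →
    mk⇔ (λ t≤f → contradiction (to (t≤f⇔<a (suc k)) t≤f) λ ()) λ ()
countAtLeast-applyUpTo f (suc a) (suc h) t≤f⇔<a | no t≰f₀ =
  contradiction (from (t≤f⇔<a 0) (s≤s z≤n)) t≰f₀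

conjugate-involutive : ∀ {λs} → IsPartition λs → conjugate (conjugate λs) ≡ λs
conjugate-involutive {[]}         _            = refl
conjugate-involutive {zero ∷ _}   (_ , () ∷ _)
conjugate-involutive {suc x ∷ xs} (≥-λs@(x≥xs ∷ _) , pos) =
  Pointwise-≡⇒≡ (lookup⁻ length-eq lookup-eq)
  where
  λs = suc x ∷ xs
  λ′ₖ = λ k → countAtLeast (suc k) λs
  λ″ᵢ = λ i → countAtLeast (suc i) (conjugate λs)

  length-eq : length (conjugate (conjugate λs)) ≡ length λs
  length-eq = trans (length-applyUpTo λ″ᵢ (countAtLeast 1 λs)) (countAtLeast-all λs pos)

  lookup-eq : ∀ {i j} → toℕ i ≡ toℕ j → lookup (conjugate (conjugate λs)) i ≡ lookup λs j
  lookup-eq {i} {j} i≡j = begin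
    lookup (conjugate (conjugate λs)) i        ≡⟨ lookup-applyUpTo λ″ᵢ (countAtLeast 1 λs) i ⟩
    countAtLeast (suc (toℕ i)) (conjugate λs)  ≡⟨ countAtLeast-applyUpTo λ′ₖ (lookup λs j) (suc x) galois ⟩
    lookup λs j ⊓ suc x                        ≡⟨ m≤n⇒m⊓n≡m (lookup-≤ x≥xs j) ⟩
    lookup λs j                                ∎
    where
    open ≡-Reasoning
    galois : ∀ k → suc (toℕ i) ≤ λ′ₖ k ⇔ k < lookup λs j
    galois k = subst (λ m → m < λ′ₖ k ⇔ _) (sym i≡j) (<-countAtLeast⇔≤-lookup (suc k) ≥-λs j)

≡-conjugate⇔conjugate-≡ : ∀ {α β} → IsPartition α → IsPartition β →
                          (α ≡ conjugate β) ⇔ (conjugate α ≡ β)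
≡-conjugate⇔conjugate-≡ α-partition β-partition = mk⇔
  (λ α≡β′ → trans (cong conjugate α≡β′) (conjugate-involutive β-partition))
  (λ α′≡β → trans (sym (conjugate-involutive α-partition)) (cong conjugate α′≡β))

AllPairs-reverse : ∀ {ℓ} {R : Rel A ℓ} {xs} → AllPairs R xs → AllPairs (flip R) (reverse xs)
AllPairs-reverse {xs = []}     []           = []
AllPairs-reverse {xs = x ∷ xs} (x~xs ∷ ~xs) rewrite unfold-reverse x xs =
  AllPairs.++⁺ (AllPairs-reverse ~xs) ([] ∷ [])
               (All.map (_∷ []) (All-resp-↭ (↭-sym (↭-reverse xs)) x~xs))

toPartition-isPartition : ∀ xs → IsPartition (toPartition xs)
toPartition-isPartition xs =
  AllPairs-reverse (Linked⇒AllPairs ≤-trans (sort-↗ positives)) ,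
  All-resp-↭ (↭-sym (↭-reverse _)) (All-resp-↭ (↭-sym (sort-↭ positives)) (all-filter (0 <?_) xs))
  where positives = filter (0 <?_) xs

toPartition-↭ : ∀ {xs ys} → xs ↭ ys → toPartition xs ≡ toPartition ys
toPartition-↭ xs↭ys = cong reverse $ Pointwise-≡⇒≡ $
  ↗↭↗⇒≋ (DecTotalOrder.totalOrder ≤-decTotalOrder) (sort-↗ _) (sort-↗ _)
    (↭⇒↭ₛ (↭-trans (sort-↭ _) (↭-trans (filter-↭ (0 <?_) xs↭ys) (↭-sym (sort-↭ _)))))

-- Counting

indicator : Dec A → ℕ
indicator (yes _) = 1
indicator (no _)  = 0

indicator-no : (A? : Dec A) → ¬ A → indicator A? ≡ 0
indicator-no (yes a) ¬a = contradiction a ¬a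
indicator-no (no _)  _  = refl

indicator-cong : A ⇔ B → (A? : Dec A) (B? : Dec B) → indicator A? ≡ indicator B?
indicator-cong _   (yes _) (yes _) = refl
indicator-cong A⇔B (yes a) (no ¬b) = contradiction (to A⇔B a) ¬b
indicator-cong A⇔B (no ¬a) (yes b) = contradiction (from A⇔B b) ¬a
indicator-cong _   (no _)  (no _)  = refl

length-filter≡sum-indicator : ∀ {P : Pred A p} (P? : Decidable P) xs →
                              length (filter P? xs) ≡ sum (map (indicator ∘ P?) xs)
length-filter≡sum-indicator P? []       = refl
length-filter≡sum-indicator P? (x ∷ xs) with P? x
... | yes _ = cong suc (length-filter≡sum-indicator P? xs)
... | no  _ = length-filter≡sum-indicator P? xs

length-filter-map : ∀ {P : Pred B p} (P? : Decidable P) (f : A → B) xs →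
                    length (filter P? (map f xs)) ≡ length (filter (P? ∘ f) xs)
length-filter-map P? f []       = refl
length-filter-map P? f (x ∷ xs) with P? (f x)
... | yes _ = cong suc (length-filter-map P? f xs)
... | no  _ = length-filter-map P? f xs

length-filter-concatMap : ∀ {P : Pred B p} (P? : Decidable P) (k : A → List B) xs →
  length (filter P? (concatMap k xs)) ≡ sum (map (λ x → length (filter P? (k x))) xs)
length-filter-concatMap P? k []       = refl
length-filter-concatMap P? k (x ∷ xs) = begin
  length (filter P? (k x ++ concatMap k xs))
    ≡⟨ cong length (filter-++ P? (k x) _) ⟩
  length (filter P? (k x) ++ filter P? (concatMap k xs))
    ≡⟨ length-++ (filter P? (k x)) ⟩
  length (filter P? (k x)) + length (filter P? (concatMap k xs))
    ≡⟨ cong (length (filter P? (k x)) +_) (length-filter-concatMap P? k xs) ⟩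
  length (filter P? (k x)) + sum (map (λ x → length (filter P? (k x))) xs) ∎
  where open ≡-Reasoning

filter-filter : ∀ {P : Pred A p} {Q : Pred A q} (P? : Decidable P) (Q? : Decidable Q) xs →
                filter P? (filter Q? xs) ≡ filter (λ x → Q? x ×-dec P? x) xs
filter-filter P? Q? []       = refl
filter-filter P? Q? (x ∷ xs) with Q? x
... | no  _ = filter-filter P? Q? xs
... | yes _ with P? x
...   | yes _ = cong (x ∷_) (filter-filter P? Q? xs)
...   | no  _ = filter-filter P? Q? xs

sum-tabulate-zero : ∀ {n} (f : Fin n → ℕ) → (∀ c → f c ≡ 0) → sum (tabulate f) ≡ 0
sum-tabulate-zero {zero}  f f≡0 = refl
sum-tabulate-zero {suc n} f f≡0 =
  cong₂ _+_ (f≡0 Fin.zero) (sum-tabulate-zero (f ∘ Fin.suc) (f≡0 ∘ Fin.suc))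

sum-tabulate-single : ∀ {n} (f : Fin n → ℕ) b → (∀ c → c ≢ b → f c ≡ 0) → sum (tabulate f) ≡ f b
sum-tabulate-single f Fin.zero f≡0 =
  trans (cong (f Fin.zero +_) (sum-tabulate-zero (f ∘ Fin.suc) λ c → f≡0 (Fin.suc c) λ ()))
        (+-identityʳ (f Fin.zero))
sum-tabulate-single f (Fin.suc b) f≡0 =
  cong₂ _+_ (f≡0 Fin.zero λ ())
            (sum-tabulate-single (f ∘ Fin.suc) b λ c c≢b → f≡0 (Fin.suc c) (c≢b ∘ Fin.suc-injective))

sum-allFin-single : ∀ {n} (f : Fin n → ℕ) b → (∀ c → c ≢ b → f c ≡ 0) →
                    sum (map f (allFin n)) ≡ f b
sum-allFin-single f b f≡0 =
  trans (cong sum (map-tabulate (λ c → c) f)) (sum-tabulate-single f b f≡0)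

length-filter-allFin-single : ∀ {n} {P : Pred (Fin n) p} (P? : Decidable P) b →
                              (∀ c → P c → c ≡ b) → length (filter P? (allFin n)) ≡ indicator (P? b)
length-filter-allFin-single P? b P⇒≡b =
  trans (length-filter≡sum-indicator P? (allFin _))
        (sum-allFin-single (indicator ∘ P?) b λ c c≢b → indicator-no (P? c) (c≢b ∘ P⇒≡b c))

module _ {n r} {R : Fin n → Fin n → Set r} (R? : ∀ a b → Dec (R a b)) where

  pairsWith : (Fin n → Fin n → B) → List B
  pairsWith f = concatMap (λ a → map (f a) (filter (R? a) (allFin n))) (allFin n)

  module _ {P : Pred B p} (P? : Decidable P) (f : Fin n → Fin n → B) where

    private
      hits : Fin n → ℕ
      hits a = length (filter (λ b → R? a b ×-dec P? (f a b)) (allFin n))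

    length-filter-pairsWith : length (filter P? (pairsWith f)) ≡ sum (map hits (allFin n))
    length-filter-pairsWith =
      trans (length-filter-concatMap P? _ (allFin n)) (cong sum (map-cong row (allFin n)))
      where
      row : ∀ a → length (filter P? (map (f a) (filter (R? a) (allFin n)))) ≡ hits a
      row a = trans (length-filter-map P? (f a) (filter (R? a) (allFin n)))
                    (cong length (filter-filter (P? ∘ f a) (R? a) (allFin n)))

    length-filter-pairsWith-fst : ∀ a₀ → (∀ a b → P (f a b) ⇔ a ≡ a₀) →
                                  length (filter P? (pairsWith f)) ≡ length (filter (R? a₀) (allFin n))
    length-filter-pairsWith-fst a₀ P⇔≡a₀ = begin
      length (filter P? (pairsWith f))    ≡⟨ length-filter-pairsWith ⟩
      sum (map hits (allFin n))           ≡⟨ sum-allFin-single hits a₀ no-hits ⟩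
      hits a₀                             ≡⟨ cong length (filter-≐ _ (R? a₀) (proj₁ , all-hit) (allFin n)) ⟩
      length (filter (R? a₀) (allFin n))  ∎
      where
      open ≡-Reasoning
      no-hits : ∀ a → a ≢ a₀ → hits a ≡ 0
      no-hits a a≢a₀ = cong length $ filter-none _ $
        All.universal (λ b (_ , P) → a≢a₀ (to (P⇔≡a₀ a b) P)) (allFin n)
      all-hit : ∀ {b} → R a₀ b → R a₀ b × P (f a₀ b)
      all-hit Rab = Rab , from (P⇔≡a₀ a₀ _) refl

    length-filter-pairsWith-snd : ∀ b₀ → (∀ a b → P (f a b) ⇔ b ≡ b₀) →
      length (filter P? (pairsWith f)) ≡ length (filter (λ a → R? a b₀) (allFin n))
    length-filter-pairsWith-snd b₀ P⇔≡b₀ = begin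
      length (filter P? (pairsWith f))                   ≡⟨ length-filter-pairsWith ⟩
      sum (map hits (allFin n))                          ≡⟨ cong sum (map-cong single-hit (allFin n)) ⟩
      sum (map (λ a → indicator (R? a b₀)) (allFin n))   ≡⟨ length-filter≡sum-indicator (λ a → R? a b₀) (allFin n) ⟨
      length (filter (λ a → R? a b₀) (allFin n))         ∎
      where
      open ≡-Reasoning
      single-hit : ∀ a → hits a ≡ indicator (R? a b₀)
      single-hit a = trans
        (length-filter-allFin-single _ b₀ (λ b (_ , P) → to (P⇔≡b₀ a b) P))
        (indicator-cong (mk⇔ proj₁ (λ Rab₀ → Rab₀ , from (P⇔≡b₀ a b₀) refl)) _ (R? a b₀))

module _ {n} (π : Permutation′ n) where

  tabulate-↭-allFin : tabulate (π ⟨$⟩ʳ_) ↭ allFin n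
  tabulate-↭-allFin = ∼bag⇒↭ $ unique∧set⇒bag (tabulate⁺ injective) (allFin⁺ n) λ {i} →
    mk⇔ (λ _ → ∈-allFin i)
        (λ _ → subst (_∈ tabulate (π ⟨$⟩ʳ_)) (inverseʳ π) (∈-tabulate⁺ (π ⟨$⟩ˡ i)))
    where
    injective : ∀ {i j} → π ⟨$⟩ʳ i ≡ π ⟨$⟩ʳ j → i ≡ j
    injective πi≡πj = trans (sym (inverseˡ π)) (trans (cong (π ⟨$⟩ˡ_) πi≡πj) (inverseˡ π))

  tabulate-∘-↭ : (f : Fin n → A) → tabulate (f ∘ (π ⟨$⟩ʳ_)) ↭ map f (allFin n)
  tabulate-∘-↭ f =
    subst (_↭ map f (allFin n)) (map-tabulate (π ⟨$⟩ʳ_) f) (↭.map⁺ f tabulate-↭-allFin)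

  length-filter-allFin-∘ : ∀ {P : Pred (Fin n) p} (P? : Decidable P) →
                           length (filter (P? ∘ (π ⟨$⟩ʳ_)) (allFin n)) ≡ length (filter P? (allFin n))
  length-filter-allFin-∘ P? = begin
    length (filter (P? ∘ (π ⟨$⟩ʳ_)) (allFin n))    ≡⟨ length-filter-map P? (π ⟨$⟩ʳ_) (allFin n) ⟨
    length (filter P? (map (π ⟨$⟩ʳ_) (allFin n)))  ≡⟨ cong (length ∘ filter P?) (map-tabulate (λ i → i) (π ⟨$⟩ʳ_)) ⟩
    length (filter P? (tabulate (π ⟨$⟩ʳ_)))        ≡⟨ ↭-length (filter-↭ P? tabulate-↭-allFin) ⟩
    length (filter P? (allFin n))                   ∎
    where open ≡-Reasoning

applyUpTo≡tabulate : (f : ℕ → A) (n : ℕ) → applyUpTo f n ≡ tabulate {n = n} (f ∘ toℕ)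
applyUpTo≡tabulate f zero    = refl
applyUpTo≡tabulate f (suc n) = cong (f 0 ∷_) (applyUpTo≡tabulate (f ∘ suc) n)

-- Rows and columns of D_σ

∸≡⇔≡∸ : ∀ {m x y} → x ≤ m → y ≤ m → m ∸ x ≡ y ⇔ x ≡ m ∸ y
∸≡⇔≡∸ {m} x≤m y≤m = mk⇔
  (λ m∸x≡y → trans (sym (m∸[m∸n]≡n x≤m)) (cong (m ∸_) m∸x≡y))
  (λ x≡m∸y → trans (cong (m ∸_) x≡m∸y) (m∸[m∸n]≡n y≤m))

row≡⇔≡opposite : ∀ {n} (r b : Fin n) → suc n ∸ (toℕ b + 1) ≡ suc (toℕ r) ⇔ b ≡ opposite r
row≡⇔≡opposite {n} r b = mk⇔
  (λ e → Fin.toℕ-injective (trans (to flipped (trans (sym shift) e)) (sym (Fin.opposite-prop r))))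
  (λ b≡r′ → trans shift (from flipped (trans (cong toℕ b≡r′) (Fin.opposite-prop r))))
  where
  shift : suc n ∸ (toℕ b + 1) ≡ n ∸ toℕ b
  shift = cong (suc n ∸_) (+-comm (toℕ b) 1)
  flipped : n ∸ toℕ b ≡ suc (toℕ r) ⇔ toℕ b ≡ n ∸ suc (toℕ r)
  flipped = ∸≡⇔≡∸ (Fin.toℕ≤n b) (Fin.toℕ<n r)

column≡⇔≡ : ∀ {n} (c a : Fin n) → toℕ a + 1 ≡ suc (toℕ c) ⇔ a ≡ c
column≡⇔≡ c a = mk⇔
  (λ e → Fin.toℕ-injective (suc-injective (trans (+-comm 1 (toℕ a)) e)))
  (λ a≡c → trans (+-comm (toℕ a) 1) (cong (suc ∘ toℕ) a≡c))

module _ {n} (σ : Permutation′ n) where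

  private
    σ⁻¹ : Fin n → Fin n
    σ⁻¹ = σ ⟨$⟩ˡ_

    -- Inv σ = pairsWith (inv? σ) encode and Dσ σ = map cell (Inv σ) hold definitionally.
    encode : Fin n → Fin n → ℕ × ℕ
    encode a b = (toℕ a + 1 , toℕ b + 1)

    cell : ℕ × ℕ → ℕ × ℕ
    cell ab = (suc n ∸ proj₂ ab , proj₁ ab)

  inv⇔inverted-positions : ∀ a b →
    (σ⁻¹ b Fin.< σ⁻¹ a × σ ⟨$⟩ʳ σ⁻¹ a Fin.< σ ⟨$⟩ʳ σ⁻¹ b) ⇔ (a Fin.< b × σ⁻¹ b Fin.< σ⁻¹ a)
  inv⇔inverted-positions a b = mk⇔
    (λ (b<a , σa<σb) → subst₂ Fin._<_ (inverseʳ σ) (inverseʳ σ) σa<σb , b<a)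
    (λ (a<b , b<a) → b<a , subst₂ Fin._<_ (sym (inverseʳ σ)) (sym (inverseʳ σ)) a<b)

  d∘σ⁻¹ : ∀ b → d σ (σ⁻¹ b) ≡ length (filter (λ a → inv? σ a b) (allFin n))
  d∘σ⁻¹ b = trans (sym (length-filter-allFin-∘ (Perm.flip σ) _)) $ cong length $
    filter-≐ _ _ (to (inv⇔inverted-positions _ b) , from (inv⇔inverted-positions _ b)) (allFin n)

  g∘σ⁻¹ : ∀ a → g σ (σ⁻¹ a) ≡ length (filter (inv? σ a) (allFin n))
  g∘σ⁻¹ a = trans (sym (length-filter-allFin-∘ (Perm.flip σ) _)) $ cong length $
    filter-≐ _ _ (to (inv⇔inverted-positions a _) , from (inv⇔inverted-positions a _)) (allFin n)

  rowLength-Dσ : ∀ r → rowLength (Dσ σ) (suc (toℕ r)) ≡ d σ (σ⁻¹ (opposite r))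
  rowLength-Dσ r = begin
    rowLength (Dσ σ) (suc (toℕ r))
      ≡⟨ length-filter-map (λ x → proj₁ x ≟ suc (toℕ r)) cell (Inv σ) ⟩
    length (filter (λ x → proj₁ (cell x) ≟ suc (toℕ r)) (pairsWith (inv? σ) encode))
      ≡⟨ length-filter-pairsWith-snd (inv? σ) _ encode (opposite r) (λ _ b → row≡⇔≡opposite r b) ⟩
    length (filter (λ a → inv? σ a (opposite r)) (allFin n))
      ≡⟨ d∘σ⁻¹ (opposite r) ⟨
    d σ (σ⁻¹ (opposite r)) ∎
    where open ≡-Reasoning

  columnLength-Dσ : ∀ c → colLength (Dσ σ) (suc (toℕ c)) ≡ g σ (σ⁻¹ c)
  columnLength-Dσ c = begin
    colLength (Dσ σ) (suc (toℕ c))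
      ≡⟨ length-filter-map (λ x → proj₂ x ≟ suc (toℕ c)) cell (Inv σ) ⟩
    length (filter (λ x → proj₂ (cell x) ≟ suc (toℕ c)) (pairsWith (inv? σ) encode))
      ≡⟨ length-filter-pairsWith-fst (inv? σ) _ encode c (λ a _ → column≡⇔≡ c a) ⟩
    length (filter (inv? σ c) (allFin n))
      ≡⟨ g∘σ⁻¹ c ⟨
    g σ (σ⁻¹ c) ∎
    where open ≡-Reasoning

  -- (Perm.reverse ∘ₚ Perm.flip σ) ⟨$⟩ʳ r reduces to σ⁻¹ (opposite r).
  rowLengths-↭ : applyUpTo (λ r → rowLength (Dσ σ) (suc r)) n ↭ map (d σ) (allFin n)
  rowLengths-↭ =
    subst (_↭ map (d σ) (allFin n)) (sym (trans (applyUpTo≡tabulate _ n) (tabulate-cong rowLength-Dσ)))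
          (tabulate-∘-↭ (Perm.reverse ∘ₚ Perm.flip σ) (d σ))

  columnLengths-↭ : applyUpTo (λ c → colLength (Dσ σ) (suc c)) n ↭ map (g σ) (allFin n)
  columnLengths-↭ =
    subst (_↭ map (g σ) (allFin n)) (sym (trans (applyUpTo≡tabulate _ n) (tabulate-cong columnLength-Dσ)))
          (tabulate-∘-↭ (Perm.flip σ) (g σ))

mainTheorem12 : (n : ℕ) (σ : Permutation′ n) → Vexillary σ ⇔ (ρXY σ ≡ ρYX σ)
mainTheorem12 n σ =
  subst₂ (λ α β → Vexillary σ ⇔ (α ≡ β)) (sym ρXY≡conjugate-λ′) (sym ρYX≡μ)
    (≡-conjugate⇔conjugate-≡ (toPartition-isPartition (map (g σ) (allFin n)))
                             (toPartition-isPartition (map (d σ) (allFin n))))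
  where
  ρYX≡μ : ρYX σ ≡ μ σ
  ρYX≡μ = toPartition-↭ (rowLengths-↭ σ)
  ρXY≡conjugate-λ′ : ρXY σ ≡ conjugate (λ′ σ)
  ρXY≡conjugate-λ′ = cong conjugate (toPartition-↭ (columnLengths-↭ σ))
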